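{- Let $P$ be a finite thin poset and suppose that the diamond space $X(P)$ is the 2-skeleton of a regular CW complex $Z(P)$ in which each 3-cell has an even number of 2-dimensional faces (2-cells in its boundary), and suppose that $H^2(Z(P);\mathbb{Z}_2)=0$. Then $P$ is balanced colorable.
   Context: All posets are finite. A graded poset (with rank function $\mathrm{rk}$ satisfying $\mathrm{rk}(y)=\mathrm{rk}(x)+1$ for covers $x\lessdot y$) is thin if every nonempty closed interval of length 2 has exactly 4 elements; these intervals are called diamonds. The diamond space $X(P)$ is the 2-dimensional regular CW complex with 0-cells the elements of $P$, a 1-cell for each cover relation $x\lessdot y$ joining $x$ and $y$, and a 2-cell glued along the boundary 4-cycle of each diamond. Let $C(P)$ be the set of cover relations of $P$. A balanced coloring of $P$ is a function $c:C(P)\to\{1,-1\}$ such that the product of $c$ over the four edges of each diamond is $-1$; $P$ is balanced colorable if it admits one. -}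

module Defs where

open import Data.Nat using (ℕ; suc)
open import Data.Nat.Divisibility using (_∣_)
open import Data.Fin using (Fin)
open import Data.Bool using (Bool; false; _xor_)
open import Data.Sign using (Sign) renaming (_*_ to _·_)
open import Data.List using (List; map; foldr; length)
open import Data.List.Relation.Unary.All using (All)
open import Data.List.Relation.Unary.Unique.Propositional using (Unique)
open import Data.Product using (Σ; _×_; _,_)
open import Function.Bundles using (_↔_)
open import Relation.Binary.PropositionalEquality using (_≡_; _≢_)
open import Relation.Binary.Definitions using (Decidable; Irrelevant)
open import Relation.Binary.Structures using (IsPartialOrder)
open import Relation.Nullary using (¬_)

record GradedPoset : Set₁ where
  field
    n    : ℕ
    _≤_  : Fin n → Fin n → Set
    isPartialOrder : IsPartialOrder _≡_ _≤_
    ≤-dec        : Decidable _≤_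
    ≤-irrelevant : Irrelevant _≤_

  _<_ : Fin n → Fin n → Set
  x < y = x ≤ y × x ≢ y

  _⋖_ : Fin n → Fin n → Set
  x ⋖ y = x < y × (∀ z → x < z → ¬ (z < y))

  field
    rk    : Fin n → ℕ
    rk-⋖  : ∀ {x y} → x ⋖ y → rk y ≡ suc (rk x)

  Interval : Fin n → Fin n → Set
  Interval x y = Σ (Fin n) λ z → x ≤ z × z ≤ y

  Length2 : Fin n → Fin n → Set
  Length2 x y = x ≤ y × rk y ≡ suc (suc (rk x))

  Diamond : Fin n → Fin n → Fin n → Fin n → Set
  Diamond x a b y = x ⋖ a × a ⋖ y × x ⋖ b × b ⋖ y × a ≢ b

open GradedPoset public

Thin : GradedPoset → Set
Thin P = ∀ x y → Length2 P x y → Fin 4 ↔ Interval P x y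

-- A coloring of the cover relations (values on non-covers are irrelevant).
Coloring : GradedPoset → Set
Coloring P = Fin (n P) → Fin (n P) → Sign

IsBalanced : (P : GradedPoset) → Coloring P → Set
IsBalanced P c = ∀ x a b y → Diamond P x a b y →
  c x a · c a y · c x b · c b y ≡ Sign.-

BalancedColorable : GradedPoset → Set
BalancedColorable P = Σ (Coloring P) (IsBalanced P)

-- The 3-cells of a regular CW complex Z(P) whose 2-skeleton is X(P):
-- a finite set Fin m of 3-cells, each with the list of its 2-dimensional
-- faces.  Every 2-cell of X(P) is a diamond, identified by the pair (x , y)
-- of its bottom and top elements (the interval [x,y]).
record ThreeCells (P : GradedPoset) : Set where
  field
    m        : ℕ
    faces    : Fin m → List (Fin (n P) × Fin (n P))
    faces-diamonds : ∀ j → All (λ { (x , y) → Length2 P x y }) (faces j)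
    faces-unique   : ∀ j → Unique (faces j)

open ThreeCells public

EvenFaces : {P : GradedPoset} → ThreeCells P → Set
EvenFaces Z = ∀ j → 2 ∣ length (faces Z j)

-- Cellular cochains with Z₂ = Bool (addition = xor).
-- 2-cochains: functions on diamonds (x , y); 1-cochains: functions on covers.
Cochain2 : GradedPoset → Set
Cochain2 P = Fin (n P) → Fin (n P) → Bool

Cochain1 : GradedPoset → Set
Cochain1 P = Fin (n P) → Fin (n P) → Bool

δ₂ : {P : GradedPoset} (Z : ThreeCells P) → Cochain2 P → Fin (m Z) → Bool
δ₂ Z f j = foldr _xor_ false (map (λ { (x , y) → f x y }) (faces Z j))

IsCocycle2 : {P : GradedPoset} (Z : ThreeCells P) → Cochain2 P → Set
IsCocycle2 Z f = ∀ j → δ₂ Z f j ≡ false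

IsCoboundary2 : (P : GradedPoset) → Cochain2 P → Set
IsCoboundary2 P f = Σ (Cochain1 P) λ g →
  ∀ x a b y → Diamond P x a b y →
    f x y ≡ g x a xor g a y xor g x b xor g b y

H²Vanishes : {P : GradedPoset} → ThreeCells P → Set
H²Vanishes {P} Z = ∀ (f : Cochain2 P) → IsCocycle2 Z f → IsCoboundary2 P f

module Submission where

-- Let 1 be the constant 2-cochain with value 1 on every diamond.
-- Its coboundary at a 3-cell is the number of 2-faces of that cell mod 2,
-- which vanishes because every 3-cell has an even number of faces; so 1 is
-- a 2-cocycle.  Since H²(Z(P); Z₂) = 0, it is a coboundary: 1 = δg for some
-- 1-cochain g, i.e. over the four edges of every diamond g sums to 1 in Z₂.
-- Transporting g along the group isomorphism Z₂ ≅ {+1, -1} (0 ↦ +1, 1 ↦ -1)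
-- turns the sum over the four edges into a product equal to -1: a balanced
-- coloring.

open import Defs
open import Data.Nat using (ℕ; zero; suc; _*_)
open import Data.Nat.Divisibility using (divides)
open import Data.Bool using (Bool; true; false; not; _xor_; if_then_else_)
open import Data.Sign using (Sign) renaming (_*_ to _·_)
open import Data.Sign.Properties using (*-assoc)
open import Data.List using (List; []; _∷_; map; foldr; length)
open import Data.Product using (_,_)
open import Relation.Binary.PropositionalEquality
  using (_≡_; refl; cong; cong₂; sym; module ≡-Reasoning)

isOdd : ℕ → Bool
isOdd zero    = false
isOdd (suc k) = not (isOdd k)

isOdd-even : ∀ k → isOdd (k * 2) ≡ false
isOdd-even zero    = refl
isOdd-even (suc k) = cong (λ b → not (not b)) (isOdd-even k)

xorSum-ones : {A : Set} (h : A → Bool) → (∀ a → h a ≡ true) → (l : List A) →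
  foldr _xor_ false (map h l) ≡ isOdd (length l)
xorSum-ones h h≡true []      = refl
xorSum-ones h h≡true (a ∷ l) =
  cong₂ _xor_ (h≡true a) (xorSum-ones h h≡true l)

ones-cocycle : {P : GradedPoset} (Z : ThreeCells P) →
  EvenFaces Z → IsCocycle2 Z (λ _ _ → true)
ones-cocycle Z even j with even j
... | divides k |faces|≡2k = begin
  δ₂ Z (λ _ _ → true) j           ≡⟨ xorSum-ones _ (λ _ → refl) (faces Z j) ⟩
  isOdd (length (faces Z j))      ≡⟨ cong isOdd |faces|≡2k ⟩
  isOdd (k * 2)                   ≡⟨ isOdd-even k ⟩
  false                           ∎
  where open ≡-Reasoning

toSign : Bool → Sign
toSign b = if b then Sign.- else Sign.+

toSign-xor : ∀ a b → toSign (a xor b) ≡ toSign a · toSign b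
toSign-xor false false = refl
toSign-xor false true  = refl
toSign-xor true  false = refl
toSign-xor true  true  = refl

sign-product-odd : ∀ a b c d → a xor b xor c xor d ≡ true →
  toSign a · toSign b · toSign c · toSign d ≡ Sign.-
sign-product-odd a b c d sum≡1 = begin
  toSign a · toSign b · toSign c · toSign d
    ≡⟨ *-assoc (toSign a · toSign b) (toSign c) (toSign d) ⟩
  toSign a · toSign b · (toSign c · toSign d)
    ≡⟨ *-assoc (toSign a) (toSign b) (toSign c · toSign d) ⟩
  toSign a · (toSign b · (toSign c · toSign d))
    ≡⟨ sym (cong (λ s → toSign a · (toSign b · s)) (toSign-xor c d)) ⟩
  toSign a · (toSign b · toSign (c xor d))
    ≡⟨ sym (cong (toSign a ·_) (toSign-xor b (c xor d))) ⟩
  toSign a · toSign (b xor c xor d)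
    ≡⟨ sym (toSign-xor a (b xor c xor d)) ⟩
  toSign (a xor b xor c xor d)
    ≡⟨ cong toSign sum≡1 ⟩
  Sign.-
    ∎
  where open ≡-Reasoning

coboundary-of-ones⇒balanced : (P : GradedPoset) →
  IsCoboundary2 P (λ _ _ → true) → BalancedColorable P
coboundary-of-ones⇒balanced P (g , δg≡1) =
  (λ x y → toSign (g x y)) ,
  λ x a b y diamond →
    sign-product-odd (g x a) (g a y) (g x b) (g b y) (sym (δg≡1 x a b y diamond))

mainTheorem4 : (P : GradedPoset) → Thin P → (Z : ThreeCells P) →
    EvenFaces Z → H²Vanishes Z → BalancedColorable P
mainTheorem4 P _ Z even h²≡0 =
  coboundary-of-ones⇒balanced P (h²≡0 (λ _ _ → true) (ones-cocycle Z even))
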